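{- Let $\mathsf P$ be an $\mathcal{HOL}$ program, $I\in H_\mathsf P$ a two-valued Herbrand interpretation and $s$ a Herbrand state. Then for every expression $\mathsf E$, $[\![\mathsf E]\!]_s(I)=[\![\mathsf E]\!]^*_s(I)$ (where $I$ is regarded as a three-valued interpretation).
   Context: Syntax of $\mathcal{HOL}$: types are predicate types $\pi ::= o \mid (\rho\to\pi)$ and argument types $\rho ::= \iota \mid \pi$. The alphabet has predicate variables and constants of each predicate type, individual variables and constants of type $\iota$, $\approx:\iota\to\iota\to o$, $\wedge$, $\sim$, $\leftarrow$. Terms: variables and constants; $(\mathsf E_1\ \mathsf E_2):\pi$ for terms $\mathsf E_1:\rho\to\pi$, $\mathsf E_2:\rho$. Expressions: terms; $(\sim\mathsf E)$ for a term $\mathsf E:o$; $(\mathsf E_1\approx\mathsf E_2)$ for terms of type $\iota$ (also conjunctions $\mathsf E_1\wedge\cdots\wedge\mathsf E_m$ of expressions of type $o$ as rule bodies). A program is a finite set of rules $\mathsf p\ \mathsf R_1\cdots\mathsf R_n\leftarrow\mathsf E_1\wedge\cdots\wedge\mathsf E_m$. Two-valued semantics: $[\![o]\!]=\{false,true\}$, $false<true$; $[\![\iota]\!]=U_\mathsf P$ (individual constants of $\mathsf P$); $[\![\rho\to\pi]\!]$ = all functions. $I\in H_\mathsf P$ maps individual constants to themselves and predicate constants $\mathsf p:\pi$ into $[\![\pi]\!]$. A state $s$ maps variables of type $\rho$ into $[\![\rho]\!]$. $[\![\mathsf R]\!]_s(I)=s(\mathsf R)$, $[\![\mathsf c]\!]_s(I)=\mathsf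 c$, $[\![\mathsf p]\!]_s(I)=I(\mathsf p)$, $[\![(\mathsf E_1\ \mathsf E_2)]\!]_s(I)=[\![\mathsf E_1]\!]_s(I)([\![\mathsf E_2]\!]_s(I))$, $\approx$ yields $true$ iff equal, $\sim$ is classical negation, conjunction is the meet. Three-valued semantics: $[\![o]\!]^*=\{false,undef,true\}$ with truth order $false<undef<true$ and precision order $undef\prec false$, $undef\prec true$; $[\![\iota]\!]^*=U_\mathsf P$, trivial orders; $[\![\rho\to\pi]\!]^*$ = all functions from two-valued $[\![\rho]\!]$ to $[\![\pi]\!]^*$, orders pointwise; $[\![\rho]\!]\subseteq[\![\rho]\!]^*$, hence $H_\mathsf P$ is included in the set of three-valued interpretations (which map $\mathsf p:\pi$ into $[\![\pi]\!]^*$). For a three-valued interpretation $\mathcal I$: $[\![\mathsf R]\!]^*_s(\mathcal I)=s(\mathsf R)$, $[\![\mathsf c]\!]^*_s(\mathcal I)=\mathsf c$, $[\![\mathsf p]\!]^*_s(\mathcal I)=\mathcal I(\mathsf p)$, $[\![(\mathsf E_1\ \mathsf E_2)]\!]^*_s(\mathcal I)=\bigwedge_{\preceq_\pi}\{[\![\mathsf E_1]\!]^*_s(\mathcal I)(d)\mid d\in[\![\rho]\!],\ [\![\mathsf E_2]\!]^*_s(\mathcal I)\preceq_\rho d\}$ for $\mathsf E_1:\rho\to\pi$, $\mathsf E_2:\rho$; $[\![\mathsf E_1\approx\mathsf E_2]\!]^*_s(\mathcal I)=true$ if the values are equal and $false$ otherwise; $[\![\sim\mathsf E]\!]^*_s(\mathcal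 I)$ swaps $true/false$ and maps $undef$ to $undef$; conjunction is the $\le_o$-meet. -}

module Defs where

open import Data.Bool using (Bool; true; false; not; if_then_else_) renaming (_∧_ to _&&_)
open import Data.Nat using (ℕ)
open import Data.Product using (Σ; _×_; _,_; proj₁)
open import Data.List using (List)
open import Relation.Binary.PropositionalEquality using (_≡_)
open import Relation.Binary.Definitions using (DecidableEquality)
open import Relation.Nullary.Decidable using (does)

-- Types of HOL:  π ::= o | ρ → π ,   ρ ::= ι | π

mutual
  data PT : Set where
    o   : PT
    _⇒_ : AT → PT → PT

  data AT : Set where
    ι   : AT
    ⌜_⌝ : PT → AT

infixr 5 _⇒_

-- Alphabet (constants).  Variables of type ρ are named by natural numbers
-- (a variable is a pair (ρ , n)), so there are infinitely many of each type.

record Signature : Set₁ where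
  field
    IConst : Set
    _≟_    : DecidableEquality IConst
    PConst : PT → Set

module _ (S : Signature) where
  open Signature S

  data Term : AT → Set where
    var  : ∀ {ρ} → ℕ → Term ρ
    icon : IConst → Term ι
    pcon : ∀ {π} → PConst π → Term ⌜ π ⌝
    app  : ∀ {ρ π} → Term ⌜ ρ ⇒ π ⌝ → Term ρ → Term ⌜ π ⌝

  data Expr : AT → Set where
    term : ∀ {ρ} → Term ρ → Expr ρ
    neg  : Term ⌜ o ⌝ → Expr ⌜ o ⌝
    eqE  : Term ι → Term ι → Expr ⌜ o ⌝
    conj : Expr ⌜ o ⌝ → Expr ⌜ o ⌝ → Expr ⌜ o ⌝

  -- clause heads  p R₁ ⋯ Rₙ  (Rᵢ variables of the argument types)
  data HeadArgs : PT → Set where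
    done : HeadArgs o
    arg  : ∀ {ρ π} → ℕ → HeadArgs π → HeadArgs (ρ ⇒ π)

  record Rule : Set where
    field
      headType : PT
      headPred : PConst headType
      headVars : HeadArgs headType
      body     : List (Expr ⌜ o ⌝)

-- A program: its alphabet (whose individual constants form U_P) and its rules.
record Program : Set₁ where
  field
    sig   : Signature
    rules : List (Rule sig)

data Tri : Set where
  ff uu tt : Tri

toTri : Bool → Tri
toTri false = ff
toTri true  = tt

negT : Tri → Tri
negT ff = tt
negT uu = uu
negT tt = ff

-- meet in the truth order  false < undef < true
_⊓_ : Tri → Tri → Tri
ff ⊓ _  = ff
uu ⊓ ff = ff
uu ⊓ _  = uu
tt ⊓ y  = y

data _⊑o_ : Tri → Tri → Set where
  u⊑ : ∀ {x} → uu ⊑o x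
  r⊑ : ∀ {x} → x ⊑o x

module _ (P : Program) where
  open Program P
  open Signature sig

  mutual
    ⟦_⟧π : PT → Set
    ⟦ o ⟧π     = Bool
    ⟦ ρ ⇒ π ⟧π = ⟦ ρ ⟧ρ → ⟦ π ⟧π

    ⟦_⟧ρ : AT → Set
    ⟦ ι ⟧ρ     = IConst          -- U_P
    ⟦ ⌜ π ⌝ ⟧ρ = ⟦ π ⟧π

  -- three-valued domains: functions from two-valued arguments
  mutual
    ⟦_⟧*π : PT → Set
    ⟦ o ⟧*π     = Tri
    ⟦ ρ ⇒ π ⟧*π = ⟦ ρ ⟧ρ → ⟦ π ⟧*π

    ⟦_⟧*ρ : AT → Set
    ⟦ ι ⟧*ρ     = IConst
    ⟦ ⌜ π ⌝ ⟧*ρ = ⟦ π ⟧*π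

  mutual
    embπ : ∀ π → ⟦ π ⟧π → ⟦ π ⟧*π
    embπ o       b = toTri b
    embπ (ρ ⇒ π) f = λ d → embπ π (f d)

    embρ : ∀ ρ → ⟦ ρ ⟧ρ → ⟦ ρ ⟧*ρ
    embρ ι       c = c
    embρ ⌜ π ⌝   x = embπ π x

  mutual
    _⪯π_ : ∀ {π} → ⟦ π ⟧*π → ⟦ π ⟧*π → Set
    _⪯π_ {o}     x y = x ⊑o y
    _⪯π_ {ρ ⇒ π} f g = ∀ d → f d ⪯π g d

    _⪯ρ_ : ∀ {ρ} → ⟦ ρ ⟧*ρ → ⟦ ρ ⟧*ρ → Set
    _⪯ρ_ {ι}     x y = x ≡ y
    _⪯ρ_ {⌜ π ⌝} x y = _⪯π_ {π} x y

  mutual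
    _≈π_ : ∀ {π} → ⟦ π ⟧*π → ⟦ π ⟧*π → Set
    _≈π_ {o}     x y = x ≡ y
    _≈π_ {ρ ⇒ π} f g = ∀ d → f d ≈π g d

    _≈ρ_ : ∀ {ρ} → ⟦ ρ ⟧*ρ → ⟦ ρ ⟧*ρ → Set
    _≈ρ_ {ι}     x y = x ≡ y
    _≈ρ_ {⌜ π ⌝} x y = _≈π_ {π} x y

  IsMeet : ∀ π {A : Set} → (A → ⟦ π ⟧*π) → ⟦ π ⟧*π → Set
  IsMeet π {A} F v =
    (∀ x → _⪯π_ {π} v (F x)) ×
    (∀ w → (∀ x → _⪯π_ {π} w (F x)) → _⪯π_ {π} w v)

  Herbrand : Set
  Herbrand = ∀ {π} → PConst π → ⟦ π ⟧π

  Interp3 : Set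
  Interp3 = ∀ {π} → PConst π → ⟦ π ⟧*π

  asInterp3 : Herbrand → Interp3
  asInterp3 I {π} p = embπ π (I p)

  State : Set
  State = (ρ : AT) → ℕ → ⟦ ρ ⟧ρ

  ⟦_⟧t : ∀ {ρ} → Term sig ρ → State → Herbrand → ⟦ ρ ⟧ρ
  ⟦ var {ρ} n ⟧t s I = s ρ n
  ⟦ icon c ⟧t    s I = c
  ⟦ pcon p ⟧t    s I = I p
  ⟦ app E₁ E₂ ⟧t s I = ⟦ E₁ ⟧t s I (⟦ E₂ ⟧t s I)

  ⟦_⟧e : ∀ {ρ} → Expr sig ρ → State → Herbrand → ⟦ ρ ⟧ρ
  ⟦ term E ⟧e    s I = ⟦ E ⟧t s I
  ⟦ neg E ⟧e     s I = not (⟦ E ⟧t s I)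
  ⟦ eqE E₁ E₂ ⟧e s I = does (⟦ E₁ ⟧t s I ≟ ⟦ E₂ ⟧t s I)
  ⟦ conj E₁ E₂ ⟧e s I = ⟦ E₁ ⟧e s I && ⟦ E₂ ⟧e s I

  -- three-valued semantics, as a relation  [[E]]*_s(𝓘) = v
  -- (the meet in the application case is over a possibly infinite set,
  --  so it is characterised as a greatest lower bound)
  data Sem3t (𝓘 : Interp3) (s : State) : ∀ {ρ} → Term sig ρ → ⟦ ρ ⟧*ρ → Set where
    var  : ∀ {ρ} n → Sem3t 𝓘 s (var {ρ = ρ} n) (embρ ρ (s ρ n))
    icon : ∀ c → Sem3t 𝓘 s (icon c) c
    pcon : ∀ {π} (p : PConst π) → Sem3t 𝓘 s (pcon p) (𝓘 p)
    app  : ∀ {ρ π} {E₁ : Term sig ⌜ ρ ⇒ π ⌝} {E₂ : Term sig ρ}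
             {f : ⟦ ρ ⇒ π ⟧*π} {a : ⟦ ρ ⟧*ρ} {v : ⟦ π ⟧*π} →
           Sem3t 𝓘 s E₁ f → Sem3t 𝓘 s E₂ a →
           IsMeet π {Σ ⟦ ρ ⟧ρ (λ d → _⪯ρ_ {ρ} a (embρ ρ d))} (λ x → f (proj₁ x)) v →
           Sem3t 𝓘 s (app E₁ E₂) v

  data Sem3e (𝓘 : Interp3) (s : State) : ∀ {ρ} → Expr sig ρ → ⟦ ρ ⟧*ρ → Set where
    term : ∀ {ρ} {E : Term sig ρ} {v} → Sem3t 𝓘 s E v → Sem3e 𝓘 s (term E) v
    neg  : ∀ {E v} → Sem3t 𝓘 s E v → Sem3e 𝓘 s (neg E) (negT v)
    eqE  : ∀ {E₁ E₂ x y} → Sem3t 𝓘 s E₁ x → Sem3t 𝓘 s E₂ y →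
           Sem3e 𝓘 s (eqE E₁ E₂) (if does (x ≟ y) then tt else ff)
    conj : ∀ {E₁ E₂ x y} → Sem3e 𝓘 s E₁ x → Sem3e 𝓘 s E₂ y →
           Sem3e 𝓘 s (conj E₁ E₂) (x ⊓ y)

{-# OPTIONS --safe #-}
module Submission where

-- Two-valued values are maximal in the precision order: if emb x ⪯ emb d
-- then x = d.  Hence in an application the meet ranges over the single
-- argument ⟦E₂⟧, and the three-valued value of every expression is the
-- embedding of its two-valued value.  Uniqueness follows since the
-- three-valued semantics is deterministic (meets are unique by antisymmetry).

open import Defs
open import Data.Bool using (true; false; not; if_then_else_) renaming (_∧_ to _&&_)
open import Data.Product using (Σ; _×_; _,_; proj₁)
open import Level using (0ℓ)
open import Relation.Binary.PropositionalEquality using (_≡_; refl; cong; cong₂; subst)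
open import Relation.Nullary.Decidable using (does)
open import Axiom.Extensionality.Propositional using (Extensionality)

negT-toTri : ∀ b → negT (toTri b) ≡ toTri (not b)
negT-toTri false = refl
negT-toTri true  = refl

if-tt-ff≡toTri : ∀ b → (if b then tt else ff) ≡ toTri b
if-tt-ff≡toTri false = refl
if-tt-ff≡toTri true  = refl

⊓-toTri : ∀ a b → toTri a ⊓ toTri b ≡ toTri (a && b)
⊓-toTri false b     = refl
⊓-toTri true  false = refl
⊓-toTri true  true  = refl

module _ (P : Program) where
  open Program P
  open Signature sig

  ⪯π-refl : ∀ π (v : ⟦_⟧*π P π) → _⪯π_ P {π} v v
  ⪯π-refl o       v = r⊑
  ⪯π-refl (ρ ⇒ π) f = λ d → ⪯π-refl π (f d)

  ⪯ρ-refl : ∀ ρ (v : ⟦_⟧*ρ P ρ) → _⪯ρ_ P {ρ} v v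
  ⪯ρ-refl ι     v = refl
  ⪯ρ-refl ⌜ π ⌝ v = ⪯π-refl π v

  IsMeet-minimum : ∀ π {A : Set} (F : A → ⟦_⟧*π P π) (i : A) →
                   (∀ j → _⪯π_ P {π} (F i) (F j)) → IsMeet P π F (F i)
  IsMeet-minimum π F i minimal = minimal , λ _ lower → lower i

  module _ (ext : Extensionality 0ℓ 0ℓ) where

    ⪯π-antisym : ∀ π {v w : ⟦_⟧*π P π} →
                 _⪯π_ P {π} v w → _⪯π_ P {π} w v → v ≡ w
    ⪯π-antisym o       u⊑ u⊑ = refl
    ⪯π-antisym o       u⊑ r⊑ = refl
    ⪯π-antisym o       r⊑ _  = refl
    ⪯π-antisym (ρ ⇒ π) p  q  = ext λ d → ⪯π-antisym π (p d) (q d)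

    IsMeet-unique : ∀ π {A : Set} {F : A → ⟦_⟧*π P π} {v w} →
                    IsMeet P π F v → IsMeet P π F w → v ≡ w
    IsMeet-unique π (v-lower , v-greatest) (w-lower , w-greatest) =
      ⪯π-antisym π (w-greatest _ v-lower) (v-greatest _ w-lower)

    embπ-⪯⇒≡ : ∀ π {x d : ⟦_⟧π P π} → _⪯π_ P {π} (embπ P π x) (embπ P π d) → x ≡ d
    embπ-⪯⇒≡ o {false} {false} r⊑ = refl
    embπ-⪯⇒≡ o {true}  {true}  r⊑ = refl
    embπ-⪯⇒≡ (ρ ⇒ π) p = ext λ e → embπ-⪯⇒≡ π (p e)

    embρ-⪯⇒≡ : ∀ ρ {x d : ⟦_⟧ρ P ρ} → _⪯ρ_ P {ρ} (embρ P ρ x) (embρ P ρ d) → x ≡ d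
    embρ-⪯⇒≡ ι     p = p
    embρ-⪯⇒≡ ⌜ π ⌝ p = embπ-⪯⇒≡ π p

    module _ {𝓘 : Interp3 P} {s : State P} where

      Sem3t-deterministic : ∀ {ρ} {E : Term sig ρ} {v w} →
                            Sem3t P 𝓘 s E v → Sem3t P 𝓘 s E w → v ≡ w
      Sem3t-deterministic (var n)  (var .n)  = refl
      Sem3t-deterministic (icon c) (icon .c) = refl
      Sem3t-deterministic (pcon p) (pcon .p) = refl
      Sem3t-deterministic (app {π = π} f a v-meet) (app f′ a′ w-meet)
        with Sem3t-deterministic f f′ | Sem3t-deterministic a a′
      ... | refl | refl = IsMeet-unique π v-meet w-meet

      Sem3e-deterministic : ∀ {ρ} {E : Expr sig ρ} {v w} →
                            Sem3e P 𝓘 s E v → Sem3e P 𝓘 s E w → v ≡ w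
      Sem3e-deterministic (term e) (term e′) = Sem3t-deterministic e e′
      Sem3e-deterministic (neg e)  (neg e′)  = cong negT (Sem3t-deterministic e e′)
      Sem3e-deterministic (eqE e₁ e₂) (eqE e₁′ e₂′) =
        cong₂ (λ x y → if does (x ≟ y) then tt else ff)
              (Sem3t-deterministic e₁ e₁′) (Sem3t-deterministic e₂ e₂′)
      Sem3e-deterministic (conj e₁ e₂) (conj e₁′ e₂′) =
        cong₂ _⊓_ (Sem3e-deterministic e₁ e₁′) (Sem3e-deterministic e₂ e₂′)

    module _ (I : Herbrand P) (s : State P) where

      Sem3t-asInterp3 : ∀ {ρ} (E : Term sig ρ) →
                        Sem3t P (asInterp3 P I) s E (embρ P ρ (⟦_⟧t P E s I))
      Sem3t-asInterp3 (var n)  = var n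
      Sem3t-asInterp3 (icon c) = icon c
      Sem3t-asInterp3 (pcon p) = pcon p
      Sem3t-asInterp3 (app {ρ} {π} E₁ E₂) =
        app (Sem3t-asInterp3 E₁) (Sem3t-asInterp3 E₂)
            (IsMeet-minimum π _ (x , ⪯ρ-refl ρ _) minimal)
        where
          g = ⟦_⟧t P E₁ s I
          x = ⟦_⟧t P E₂ s I
          minimal : ∀ (j : Σ (⟦_⟧ρ P ρ) λ d → _⪯ρ_ P {ρ} (embρ P ρ x) (embρ P ρ d)) →
                    _⪯π_ P {π} (embπ P π (g x)) (embπ P π (g (proj₁ j)))
          minimal (d , x⪯d) with embρ-⪯⇒≡ ρ x⪯d
          ... | refl = ⪯π-refl π _

      Sem3e-asInterp3 : ∀ {ρ} (E : Expr sig ρ) →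
                        Sem3e P (asInterp3 P I) s E (embρ P ρ (⟦_⟧e P E s I))
      Sem3e-asInterp3 (term E) = term (Sem3t-asInterp3 E)
      Sem3e-asInterp3 (neg E) =
        subst (Sem3e P _ s (neg E)) (negT-toTri _) (neg (Sem3t-asInterp3 E))
      Sem3e-asInterp3 (eqE E₁ E₂) =
        subst (Sem3e P _ s (eqE E₁ E₂)) (if-tt-ff≡toTri _)
              (eqE (Sem3t-asInterp3 E₁) (Sem3t-asInterp3 E₂))
      Sem3e-asInterp3 (conj E₁ E₂) =
        subst (Sem3e P _ s (conj E₁ E₂)) (⊓-toTri (⟦_⟧e P E₁ s I) (⟦_⟧e P E₂ s I))
              (conj (Sem3e-asInterp3 E₁) (Sem3e-asInterp3 E₂))

lemma5p6 : Extensionality 0ℓ 0ℓ →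
           (P : Program) (I : Herbrand P) (s : State P)
           {ρ : AT} (E : Expr (Program.sig P) ρ) →
           Sem3e P (asInterp3 P I) s E (embρ P ρ (⟦_⟧e P E s I)) ×
           (∀ v → Sem3e P (asInterp3 P I) s E v →
                  v ≡ embρ P ρ (⟦_⟧e P E s I))
lemma5p6 ext P I s E =
  Sem3e-asInterp3 P ext I s E ,
  λ v v-sem → Sem3e-deterministic P ext v-sem (Sem3e-asInterp3 P ext I s E)
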